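{- Let $A$ and $B$ be arbitrary formulas of the modal language (or of the light modal language). Each instance of the following $S_4$ modal axiom schemes $$\mathsf{T}:\ \Box A\to A,\qquad \mathsf{T}^c:\ A\to\Diamond A,\qquad \mathsf{4}:\ \Box A\to\Box\Box A,\qquad \mathsf{4}^c:\ \Diamond\Diamond A\to\Diamond A,\qquad \mathsf{K}:\ [\Box(A\to B)\wedge\Box A]\to\Box B$$ is realizable in the verifying system $\mathcal{V}^\omega$ under the modal Dialectica translation (and under the light modal Dialectica translation).
   Context: Finite types: $\rho,\sigma ::= \mathbb{N}\mid\mathbb{B}\mid(\rho\sigma)$ (function types). Terms are those of Gödel's System T: typed variables, constants $\mathrm{true},\mathrm{false}:\mathbb{B}$, $0:\mathbb{N}$, successor $S$, case distinction $\mathrm{If}$, Gödel recursors $\mathrm{Rec}$, $\lambda$-abstraction and application, with the usual $\beta$-reduction and reduction rules for $\mathrm{If}$ and $\mathrm{Rec}$. Atomic formulas are $\mathrm{at}(t)$ for boolean terms $t$ (so all atoms are decidable); $\bot:=\mathrm{at}(\mathrm{false})$, $\neg A:=A\to\bot$. The verifying system $\mathcal{V}^\omega$ is classical arithmetic in all finite types in natural deduction form: formulas built from atoms by $\to,\wedge,\forall$ (with $\exists x A:=\neg\forall x\neg A$), the usual natural deduction rules for $\to,\wedge,\forall$, contraction, induction rules for booleans and naturals, the axiom $\mathrm{at}(\mathrm{true})$, equality at base types given by boolean equality functions and extensional equality at higher types ($s=_{\rho\tau}t:=\forall x^\rho(sx=_\tau tx)$), and the full compatibility axiom $x=_\rho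 y\to A(x)\to A(y)$; ex falso and stability $\neg\neg A\to A$ are provable in it. The modal language: formulas $A ::= \mathrm{at}(t)\mid A\to B\mid A\wedge B\mid \forall x^\rho A\mid \Box A$, with $\Diamond A:=\neg\Box\neg A$. The light modal language additionally has quantifiers $\forall^{+}x,\ \forall^{ - }x,\ \forall^{nc}x$. Modal Dialectica translation: to each formula $A$ one associates a $\mathcal{V}^\omega$-formula $|A|^{\underline x}_{\underline y}$ with tuples of fresh variables $\underline x$ (witness variables) and $\underline y$ (challenge variables), defined by: $|\mathrm{at}(t)|:=\mathrm{at}(t)$ (empty tuples); if $|A|^{\underline x}_{\underline y}$ and $|B|^{\underline u}_{\underline v}$ are defined, then $|A\wedge B|^{\underline x,\underline u}_{\underline y,\underline v}:=|A|^{\underline x}_{\underline y}\wedge|B|^{\underline u}_{\underline v}$; $|A\to B|^{\underline f,\underline g}_{\underline x,\underline v}:=|A|^{\underline x}_{\underline f\underline x\underline v}\to|B|^{\underline g\underline x}_{\underline v}$; $|\forall z A(z)|^{\underline f}_{z,\underline y}:=|A(z)|^{\underline f z}_{\underline y}$; $|\Box A|^{\underline x}:=\forall\underline y\,|A|^{\underline x}_{\underline y}$ (empty challenge tuple). Consequently $|\Diamond A|_{\underline f}\equiv\exists\underline x\,|A|^{\underline x}_{\underline f\underline x}$. The light modal Dialectica translation adds: $|\forall^{+}z A(z)|^{\underline f}_{\underline y}:=\forall z\,|A(z)|^{\underline f z}_{\underline y}$; $|\forall^{ - }z A(z)|^{\underline x}_{z,\underline y}:=|A(z)|^{\underline x}_{\underline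 y}$; $|\forall^{nc}z A(z)|^{\underline x}_{\underline y}:=\forall z\,|A(z)|^{\underline x}_{\underline y}$. A formula $C$ with free variables $\underline w$ is realizable in $\mathcal{V}^\omega$ under the translation if there is a tuple of terms $\underline t$ with $\mathrm{FV}(\underline t)\subseteq\{\underline w\}$ (in particular not containing the challenge variables $\underline y$) such that $\mathcal{V}^\omega\vdash |C|^{\underline t}_{\underline y}$, equivalently $\mathcal{V}^\omega\vdash\forall\underline y\,|C|^{\underline t}_{\underline y}$. -}

module Defs where

open import Data.List using (List; []; _∷_; _++_; map)
open import Data.List.Membership.Propositional using (_∈_)
open import Data.Product using (Σ; _×_; _,_)

infixr 30 _⇒_
data Ty : Set where
  𝑵 𝑩 : Ty
  _⇒_ : Ty → Ty → Ty

Ctx : Set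
Ctx = List Ty

infix 4 _∋_
data _∋_ : Ctx → Ty → Set where
  here  : ∀ {Γ ρ} → (ρ ∷ Γ) ∋ ρ
  there : ∀ {Γ ρ σ} → Γ ∋ ρ → (σ ∷ Γ) ∋ ρ

infixl 40 _·_
data Tm (Γ : Ctx) : Ty → Set where
  var   : ∀ {ρ} → Γ ∋ ρ → Tm Γ ρ
  true  : Tm Γ 𝑩
  false : Tm Γ 𝑩
  zero  : Tm Γ 𝑵
  S     : Tm Γ (𝑵 ⇒ 𝑵)
  If    : (ρ : Ty) → Tm Γ (𝑩 ⇒ ρ ⇒ ρ ⇒ ρ)
  Rec   : (ρ : Ty) → Tm Γ (𝑵 ⇒ ρ ⇒ (𝑵 ⇒ ρ ⇒ ρ) ⇒ ρ)
  lam   : ∀ {ρ σ} → Tm (ρ ∷ Γ) σ → Tm Γ (ρ ⇒ σ)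
  _·_   : ∀ {ρ σ} → Tm Γ (ρ ⇒ σ) → Tm Γ ρ → Tm Γ σ

Ren : Ctx → Ctx → Set
Ren Γ Δ = ∀ {ρ} → Γ ∋ ρ → Δ ∋ ρ

ext : ∀ {Γ Δ σ} → Ren Γ Δ → Ren (σ ∷ Γ) (σ ∷ Δ)
ext r here      = here
ext r (there x) = there (r x)

ren : ∀ {Γ Δ ρ} → Ren Γ Δ → Tm Γ ρ → Tm Δ ρ
ren r (var x)   = var (r x)
ren r true      = true
ren r false     = false
ren r zero      = zero
ren r S         = S
ren r (If ρ)    = If ρ
ren r (Rec ρ)   = Rec ρ
ren r (lam t)   = lam (ren (ext r) t)
ren r (t · s)   = ren r t · ren r s

wk : ∀ {Γ ρ σ} → Tm Γ ρ → Tm (σ ∷ Γ) ρ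
wk = ren there

Sub : Ctx → Ctx → Set
Sub Γ Δ = ∀ {ρ} → Γ ∋ ρ → Tm Δ ρ

exts : ∀ {Γ Δ σ} → Sub Γ Δ → Sub (σ ∷ Γ) (σ ∷ Δ)
exts s here      = var here
exts s (there x) = wk (s x)

sub : ∀ {Γ Δ ρ} → Sub Γ Δ → Tm Γ ρ → Tm Δ ρ
sub s (var x)   = s x
sub s true      = true
sub s false     = false
sub s zero      = zero
sub s S         = S
sub s (If ρ)    = If ρ
sub s (Rec ρ)   = Rec ρ
sub s (lam t)   = lam (sub (exts s) t)
sub s (t · u)   = sub s t · sub s u

_•_ : ∀ {Γ Δ σ} → Tm Δ σ → Sub Γ Δ → Sub (σ ∷ Γ) Δ
(t • s) here      = t
(t • s) (there x) = s x

idSub : ∀ {Γ} → Sub Γ Γ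
idSub = var

_[_] : ∀ {Γ ρ σ} → Tm (σ ∷ Γ) ρ → Tm Γ σ → Tm Γ ρ
t [ u ] = sub (u • idSub) t

infix 4 _↦_
data _↦_ {Γ : Ctx} : ∀ {ρ} → Tm Γ ρ → Tm Γ ρ → Set where
  β     : ∀ {ρ σ} (t : Tm (ρ ∷ Γ) σ) (u : Tm Γ ρ) → lam t · u ↦ t [ u ]
  ifT   : ∀ {ρ} (s r : Tm Γ ρ) → If ρ · true · s · r ↦ s
  ifF   : ∀ {ρ} (s r : Tm Γ ρ) → If ρ · false · s · r ↦ r
  rec0  : ∀ {ρ} (s : Tm Γ ρ) (f : Tm Γ (𝑵 ⇒ ρ ⇒ ρ)) → Rec ρ · zero · s · f ↦ s
  recS  : ∀ {ρ} (n : Tm Γ 𝑵) (s : Tm Γ ρ) (f : Tm Γ (𝑵 ⇒ ρ ⇒ ρ)) →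
          Rec ρ · (S · n) · s · f ↦ f · n · (Rec ρ · n · s · f)

infix 4 _≈_
data _≈_ : ∀ {Γ ρ} → Tm Γ ρ → Tm Γ ρ → Set where
  step   : ∀ {Γ ρ} {t u : Tm Γ ρ} → t ↦ u → t ≈ u
  refl≈  : ∀ {Γ ρ} {t : Tm Γ ρ} → t ≈ t
  sym≈   : ∀ {Γ ρ} {t u : Tm Γ ρ} → t ≈ u → u ≈ t
  trans≈ : ∀ {Γ ρ} {t u v : Tm Γ ρ} → t ≈ u → u ≈ v → t ≈ v
  app≈   : ∀ {Γ ρ σ} {t t' : Tm Γ (ρ ⇒ σ)} {u u' : Tm Γ ρ} →
           t ≈ t' → u ≈ u' → t · u ≈ t' · u'
  lam≈   : ∀ {Γ ρ σ} {t t' : Tm (ρ ∷ Γ) σ} → t ≈ t' → lam t ≈ lam t'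

infixr 10 _⊃_
infixr 20 _∧_
data Fm (Γ : Ctx) : Set where
  at  : Tm Γ 𝑩 → Fm Γ
  _⊃_ : Fm Γ → Fm Γ → Fm Γ
  _∧_ : Fm Γ → Fm Γ → Fm Γ
  ∀'  : (ρ : Ty) → Fm (ρ ∷ Γ) → Fm Γ

⊥F : ∀ {Γ} → Fm Γ
⊥F = at false

subF : ∀ {Γ Δ} → Sub Γ Δ → Fm Γ → Fm Δ
subF s (at t)    = at (sub s t)
subF s (A ⊃ B)   = subF s A ⊃ subF s B
subF s (A ∧ B)   = subF s A ∧ subF s B
subF s (∀' ρ A)  = ∀' ρ (subF (exts s) A)

renF : ∀ {Γ Δ} → Ren Γ Δ → Fm Γ → Fm Δ
renF r = subF (λ x → var (r x))

wkF : ∀ {Γ σ} → Fm Γ → Fm (σ ∷ Γ)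
wkF = renF there

_[_]F : ∀ {Γ σ} → Fm (σ ∷ Γ) → Tm Γ σ → Fm Γ
A [ u ]F = subF (u • idSub) A

infix 4 _≈F_
data _≈F_ : ∀ {Γ} → Fm Γ → Fm Γ → Set where
  at≈ : ∀ {Γ} {t u : Tm Γ 𝑩} → t ≈ u → at t ≈F at u
  ⊃≈  : ∀ {Γ} {A A' B B' : Fm Γ} → A ≈F A' → B ≈F B' → (A ⊃ B) ≈F (A' ⊃ B')
  ∧≈  : ∀ {Γ} {A A' B B' : Fm Γ} → A ≈F A' → B ≈F B' → (A ∧ B) ≈F (A' ∧ B')
  ∀≈  : ∀ {Γ ρ} {A A' : Fm (ρ ∷ Γ)} → A ≈F A' → ∀' ρ A ≈F ∀' ρ A'

v0 : ∀ {Γ a} → Tm (a ∷ Γ) a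
v0 = var here
v1 : ∀ {Γ a b} → Tm (b ∷ a ∷ Γ) a
v1 = var (there here)
v3 : ∀ {Γ a b c d} → Tm (d ∷ c ∷ b ∷ a ∷ Γ) a
v3 = var (there (there (there here)))

eqB : ∀ {Γ} → Tm Γ (𝑩 ⇒ 𝑩 ⇒ 𝑩)
eqB = lam (lam (If 𝑩 · v1 · v0 · (If 𝑩 · v0 · false · true)))

isZero : ∀ {Γ} → Tm Γ (𝑵 ⇒ 𝑩)
isZero = lam (Rec 𝑩 · v0 · true · lam (lam false))

eqN : ∀ {Γ} → Tm Γ (𝑵 ⇒ 𝑵 ⇒ 𝑩)
eqN = lam (Rec (𝑵 ⇒ 𝑩) · v0 · isZero
           · lam (lam (lam (Rec 𝑩 · v0 · false · lam (lam (v3 · v1))))))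

Eq : ∀ {Γ} (ρ : Ty) → Tm Γ ρ → Tm Γ ρ → Fm Γ
Eq 𝑵 s t       = at (eqN · s · t)
Eq 𝑩 s t       = at (eqB · s · t)
Eq (ρ ⇒ τ) s t = ∀' ρ (Eq τ (wk s · v0) (wk t · v0))

-- A(S n) in the context of the bound variable n
succSub : ∀ {Γ} → Sub (𝑵 ∷ Γ) (𝑵 ∷ Γ)
succSub = (S · v0) • (λ x → var (there x))

-- derivations of V^ω:  Der Γ Φ A  means  Φ ⊢ A  with free variables Γ
data Der : (Γ : Ctx) → List (Fm Γ) → Fm Γ → Set where
  ass    : ∀ {Γ Φ A} → A ∈ Φ → Der Γ Φ A
  ⊃I     : ∀ {Γ Φ A B} → Der Γ (A ∷ Φ) B → Der Γ Φ (A ⊃ B)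
  ⊃E     : ∀ {Γ Φ A B} → Der Γ Φ (A ⊃ B) → Der Γ Φ A → Der Γ Φ B
  ∧I     : ∀ {Γ Φ A B} → Der Γ Φ A → Der Γ Φ B → Der Γ Φ (A ∧ B)
  ∧E₁    : ∀ {Γ Φ A B} → Der Γ Φ (A ∧ B) → Der Γ Φ A
  ∧E₂    : ∀ {Γ Φ A B} → Der Γ Φ (A ∧ B) → Der Γ Φ B
  ∀I     : ∀ {Γ Φ ρ A} → Der (ρ ∷ Γ) (map wkF Φ) A → Der Γ Φ (∀' ρ A)
  ∀E     : ∀ {Γ Φ ρ A} → Der Γ Φ (∀' ρ A) → (t : Tm Γ ρ) → Der Γ Φ (A [ t ]F)
  axTrue : ∀ {Γ Φ} → Der Γ Φ (at true)
  indB   : ∀ {Γ Φ} (A : Fm (𝑩 ∷ Γ)) →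
           Der Γ Φ (A [ true ]F ⊃ A [ false ]F ⊃ ∀' 𝑩 A)
  indN   : ∀ {Γ Φ} (A : Fm (𝑵 ∷ Γ)) →
           Der Γ Φ (A [ zero ]F ⊃ ∀' 𝑵 (A ⊃ subF succSub A) ⊃ ∀' 𝑵 A)
  compat : ∀ {Γ Φ ρ} (A : Fm (ρ ∷ Γ)) (s t : Tm Γ ρ) →
           Der Γ Φ (Eq ρ s t ⊃ A [ s ]F ⊃ A [ t ]F)
  conv   : ∀ {Γ Φ A B} → Der Γ Φ A → A ≈F B → Der Γ Φ B

data Lang : Set where
  modal light : Lang

infixr 10 _⊃ₘ_
infixr 20 _∧ₘ_
data MFm : Lang → Ctx → Set where
  atₘ  : ∀ {l Γ} → Tm Γ 𝑩 → MFm l Γ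
  _⊃ₘ_ : ∀ {l Γ} → MFm l Γ → MFm l Γ → MFm l Γ
  _∧ₘ_ : ∀ {l Γ} → MFm l Γ → MFm l Γ → MFm l Γ
  ∀ₘ   : ∀ {l Γ} (ρ : Ty) → MFm l (ρ ∷ Γ) → MFm l Γ
  □    : ∀ {l Γ} → MFm l Γ → MFm l Γ
  ∀⁺   : ∀ {Γ} (ρ : Ty) → MFm light (ρ ∷ Γ) → MFm light Γ
  ∀⁻   : ∀ {Γ} (ρ : Ty) → MFm light (ρ ∷ Γ) → MFm light Γ
  ∀ⁿᶜ  : ∀ {Γ} (ρ : Ty) → MFm light (ρ ∷ Γ) → MFm light Γ

¬ₘ : ∀ {l Γ} → MFm l Γ → MFm l Γ
¬ₘ A = A ⊃ₘ atₘ false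

◇ : ∀ {l Γ} → MFm l Γ → MFm l Γ
◇ A = ¬ₘ (□ (¬ₘ A))

infixr 25 _⇛_
_⇛_ : List Ty → Ty → Ty
[] ⇛ τ       = τ
(ρ ∷ ρs) ⇛ τ = ρ ⇒ (ρs ⇛ τ)

infixr 5 _∷ᵗ_
data Tms (Δ : Ctx) : List Ty → Set where
  []ᵗ  : Tms Δ []
  _∷ᵗ_ : ∀ {ρ ρs} → Tm Δ ρ → Tms Δ ρs → Tms Δ (ρ ∷ ρs)

_++ᵗ_ : ∀ {Δ xs ys} → Tms Δ xs → Tms Δ ys → Tms Δ (xs ++ ys)
[]ᵗ ++ᵗ us       = us
(t ∷ᵗ ts) ++ᵗ us = t ∷ᵗ (ts ++ᵗ us)

splitᵗ : ∀ {Δ} (xs : List Ty) {ys : List Ty} → Tms Δ (xs ++ ys) → Tms Δ xs × Tms Δ ys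
splitᵗ [] ts = []ᵗ , ts
splitᵗ (x ∷ xs) (t ∷ᵗ ts) with splitᵗ xs ts
... | us , vs = (t ∷ᵗ us) , vs

renᵗ : ∀ {Γ Δ xs} → Ren Γ Δ → Tms Γ xs → Tms Δ xs
renᵗ r []ᵗ       = []ᵗ
renᵗ r (t ∷ᵗ ts) = ren r t ∷ᵗ renᵗ r ts

appᵗ : ∀ {Δ τ} {xs : List Ty} → Tm Δ (xs ⇛ τ) → Tms Δ xs → Tm Δ τ
appᵗ f []ᵗ       = f
appᵗ f (t ∷ᵗ ts) = appᵗ (f · t) ts

appsᵗ : ∀ {Δ} {xs : List Ty} (ys : List Ty) → Tms Δ (map (xs ⇛_) ys) → Tms Δ xs → Tms Δ ys
appsᵗ [] []ᵗ as             = []ᵗ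
appsᵗ (y ∷ ys) (f ∷ᵗ fs) as = appᵗ f as ∷ᵗ appsᵗ ys fs as

app1ᵗ : ∀ {Δ ρ} (ys : List Ty) → Tms Δ (map (ρ ⇒_) ys) → Tm Δ ρ → Tms Δ ys
app1ᵗ [] []ᵗ a             = []ᵗ
app1ᵗ (y ∷ ys) (f ∷ᵗ fs) a = (f · a) ∷ᵗ app1ᵗ ys fs a

wk* : ∀ {Δ} (cs : List Ty) → Ren Δ (cs ++ Δ)
wk* [] x       = x
wk* (c ∷ cs) x = there (wk* cs x)

varsᵗ : ∀ {Δ} (cs : List Ty) → Tms (cs ++ Δ) cs
varsᵗ [] = []ᵗ
varsᵗ (c ∷ cs) = var here ∷ᵗ renᵗ there (varsᵗ cs)

∀* : ∀ {Δ} (cs : List Ty) → Fm (cs ++ Δ) → Fm Δ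
∀* [] F       = F
∀* (c ∷ cs) F = ∀* cs (∀' c F)

-- types of the witness tuple and of the challenge tuple
Wt Ch : ∀ {l Γ} → MFm l Γ → List Ty
Wt (atₘ t)   = []
Wt (A ⊃ₘ B)  = map ((Wt A ++ Ch B) ⇛_) (Ch A) ++ map (Wt A ⇛_) (Wt B)
Wt (A ∧ₘ B)  = Wt A ++ Wt B
Wt (∀ₘ ρ A)  = map (ρ ⇒_) (Wt A)
Wt (□ A)     = Wt A
Wt (∀⁺ ρ A)  = map (ρ ⇒_) (Wt A)
Wt (∀⁻ ρ A)  = Wt A
Wt (∀ⁿᶜ ρ A) = Wt A
Ch (atₘ t)   = []
Ch (A ⊃ₘ B)  = Wt A ++ Ch B
Ch (A ∧ₘ B)  = Ch A ++ Ch B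
Ch (∀ₘ ρ A)  = ρ ∷ Ch A
Ch (□ A)     = []
Ch (∀⁺ ρ A)  = Ch A
Ch (∀⁻ ρ A)  = ρ ∷ Ch A
Ch (∀ⁿᶜ ρ A) = Ch A

-- ∣ A ∣ σ xs ys  is  |A|^{xs}_{ys} with the free variables of A
-- instantiated by σ (witness / challenge positions filled by terms)
∣_∣ : ∀ {l Γ Δ} (A : MFm l Γ) → Sub Γ Δ → Tms Δ (Wt A) → Tms Δ (Ch A) → Fm Δ
∣ atₘ t ∣ σ xs ys = at (sub σ t)
∣ A ⊃ₘ B ∣ σ fgs xvs with splitᵗ (map ((Wt A ++ Ch B) ⇛_) (Ch A)) fgs
                        | splitᵗ (Wt A) xvs
... | fs , gs | xs , vs =
  ∣ A ∣ σ xs (appsᵗ (Ch A) fs (xs ++ᵗ vs)) ⊃ ∣ B ∣ σ (appsᵗ (Wt B) gs xs) vs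
∣ A ∧ₘ B ∣ σ xus yvs with splitᵗ (Wt A) xus | splitᵗ (Ch A) yvs
... | xs , us | ys , vs = ∣ A ∣ σ xs ys ∧ ∣ B ∣ σ us vs
∣ ∀ₘ ρ A ∣ σ fs (z ∷ᵗ ys) = ∣ A ∣ (z • σ) (app1ᵗ (Wt A) fs z) ys
∣ □ A ∣ σ xs ys =
  ∀* (Ch A) (∣ A ∣ (λ x → ren (wk* (Ch A)) (σ x)) (renᵗ (wk* (Ch A)) xs) (varsᵗ (Ch A)))
∣ ∀⁺ ρ A ∣ σ fs ys =
  ∀' ρ (∣ A ∣ (exts σ) (app1ᵗ (Wt A) (renᵗ there fs) v0) (renᵗ there ys))
∣ ∀⁻ ρ A ∣ σ xs (z ∷ᵗ ys) = ∣ A ∣ (z • σ) xs ys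
∣ ∀ⁿᶜ ρ A ∣ σ xs ys = ∀' ρ (∣ A ∣ (exts σ) (renᵗ there xs) (renᵗ there ys))

-- C (free variables Γ) is realizable: there are terms ts with free variables
-- among Γ such that V^ω ⊢ |C|^{ts}_{ys}, the challenge variables ys being
-- fresh free variables.
Realizable : ∀ {l Γ} → MFm l Γ → Set
Realizable {l} {Γ} C =
  Σ (Tms Γ (Wt C)) λ ts →
    Der (Ch C ++ Γ) []
        (∣ C ∣ (λ x → var (wk* (Ch C) x)) (renᵗ (wk* (Ch C)) ts) (varsᵗ (Ch C)))

-- Under the modal Dialectica translation □ A has no challenges, |□ A|^x being ∀ y |A|^x_y, and
-- ◇ A = ¬ □ ¬ A has no witnesses. Each axiom is therefore realized by very simple λ-terms:
-- T and 4 by the identity on witnesses of A; K by applying the B-part of the witness of A → B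
-- to the witness of A; Tᶜ by taking as challenge of A the witness of ¬ A applied to the witness
-- of A; 4ᶜ by the constant function returning the challenge. The verifications are short
-- intuitionistic derivations (4ᶜ amounts to ¬¬¬ X → ¬ X) once the realizers are β-reduced, which
-- the rule conv allows because the translation respects substitution and convertibility.

module Submission where

open import Defs
open import Data.List using (List; []; _∷_; _++_; map)
open import Data.List.Relation.Unary.Any using (here; there)
open import Data.Product using (_×_; _,_; proj₁; proj₂)
open import Data.Unit using (⊤; tt)
open import Relation.Binary.PropositionalEquality
  using (_≡_; refl; sym; trans; cong; cong₂; subst)

-- Substitution and convertibility

infix 4 _≡ˢ_ _≈ˢ_
_≡ˢ_ _≈ˢ_ : ∀ {Γ Δ} → Sub Γ Δ → Sub Γ Δ → Set
_≡ˢ_ {Γ} s s' = ∀ {ρ} (x : Γ ∋ ρ) → s x ≡ s' x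
_≈ˢ_ {Γ} s s' = ∀ {ρ} (x : Γ ∋ ρ) → s x ≈ s' x

ext-cong : ∀ {Γ Δ σ} {r r' : Ren Γ Δ} → (∀ {ρ} (x : Γ ∋ ρ) → r x ≡ r' x) →
           ∀ {ρ} (x : (σ ∷ Γ) ∋ ρ) → ext r x ≡ ext r' x
ext-cong h here      = refl
ext-cong h (there x) = cong there (h x)

ren-cong : ∀ {Γ Δ ρ} {r r' : Ren Γ Δ} → (∀ {ρ} (x : Γ ∋ ρ) → r x ≡ r' x) →
           (t : Tm Γ ρ) → ren r t ≡ ren r' t
ren-cong h (var x) = cong var (h x)
ren-cong h true    = refl
ren-cong h false   = refl
ren-cong h zero    = refl
ren-cong h S       = refl
ren-cong h (If ρ)  = refl
ren-cong h (Rec ρ) = refl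
ren-cong h (lam t) = cong lam (ren-cong (ext-cong h) t)
ren-cong h (t · u) = cong₂ _·_ (ren-cong h t) (ren-cong h u)

ren-ren : ∀ {Γ Δ Θ ρ} (r : Ren Δ Θ) (r' : Ren Γ Δ) (t : Tm Γ ρ) →
          ren r (ren r' t) ≡ ren (λ x → r (r' x)) t
ren-ren r r' (var x) = refl
ren-ren r r' true    = refl
ren-ren r r' false   = refl
ren-ren r r' zero    = refl
ren-ren r r' S       = refl
ren-ren r r' (If ρ)  = refl
ren-ren r r' (Rec ρ) = refl
ren-ren r r' (lam t) = cong lam (trans (ren-ren (ext r) (ext r') t) (ren-cong ext-∘ t))
  where
  ext-∘ : ∀ {ρ} (x : _ ∋ ρ) → ext r (ext r' x) ≡ ext (λ y → r (r' y)) x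
  ext-∘ here      = refl
  ext-∘ (there x) = refl
ren-ren r r' (t · u) = cong₂ _·_ (ren-ren r r' t) (ren-ren r r' u)

exts-cong : ∀ {Γ Δ σ} {s s' : Sub Γ Δ} → s ≡ˢ s' → exts {σ = σ} s ≡ˢ exts s'
exts-cong h here      = refl
exts-cong h (there x) = cong wk (h x)

sub-cong : ∀ {Γ Δ ρ} {s s' : Sub Γ Δ} → s ≡ˢ s' → (t : Tm Γ ρ) → sub s t ≡ sub s' t
sub-cong h (var x) = h x
sub-cong h true    = refl
sub-cong h false   = refl
sub-cong h zero    = refl
sub-cong h S       = refl
sub-cong h (If ρ)  = refl
sub-cong h (Rec ρ) = refl
sub-cong h (lam t) = cong lam (sub-cong (exts-cong h) t)
sub-cong h (t · u) = cong₂ _·_ (sub-cong h t) (sub-cong h u)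

ren-sub : ∀ {Γ Δ Θ ρ} (r : Ren Δ Θ) (s : Sub Γ Δ) (t : Tm Γ ρ) →
          ren r (sub s t) ≡ sub (λ x → ren r (s x)) t
ren-sub r s (var x) = refl
ren-sub r s true    = refl
ren-sub r s false   = refl
ren-sub r s zero    = refl
ren-sub r s S       = refl
ren-sub r s (If ρ)  = refl
ren-sub r s (Rec ρ) = refl
ren-sub r s (lam t) = cong lam (trans (ren-sub (ext r) (exts s) t) (sub-cong ext-exts t))
  where
  ext-exts : (λ x → ren (ext r) (exts s x)) ≡ˢ exts (λ x → ren r (s x))
  ext-exts here      = refl
  ext-exts (there x) = trans (ren-ren (ext r) there (s x)) (sym (ren-ren there r (s x)))
ren-sub r s (t · u) = cong₂ _·_ (ren-sub r s t) (ren-sub r s u)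

sub-ren : ∀ {Γ Δ Θ ρ} (s : Sub Δ Θ) (r : Ren Γ Δ) (t : Tm Γ ρ) →
          sub s (ren r t) ≡ sub (λ x → s (r x)) t
sub-ren s r (var x) = refl
sub-ren s r true    = refl
sub-ren s r false   = refl
sub-ren s r zero    = refl
sub-ren s r S       = refl
sub-ren s r (If ρ)  = refl
sub-ren s r (Rec ρ) = refl
sub-ren s r (lam t) = cong lam (trans (sub-ren (exts s) (ext r) t) (sub-cong exts-ext t))
  where
  exts-ext : (λ x → exts s (ext r x)) ≡ˢ exts (λ x → s (r x))
  exts-ext here      = refl
  exts-ext (there x) = refl
sub-ren s r (t · u) = cong₂ _·_ (sub-ren s r t) (sub-ren s r u)

sub-exts-wk : ∀ {Γ Δ σ ρ} (s : Sub Γ Δ) (t : Tm Γ ρ) →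
              sub (exts {σ = σ} s) (wk t) ≡ wk (sub s t)
sub-exts-wk s t = trans (sub-ren (exts s) there t) (sym (ren-sub there s t))

sub-sub : ∀ {Γ Δ Θ ρ} (s : Sub Δ Θ) (s' : Sub Γ Δ) (t : Tm Γ ρ) →
          sub s (sub s' t) ≡ sub (λ x → sub s (s' x)) t
sub-sub s s' (var x) = refl
sub-sub s s' true    = refl
sub-sub s s' false   = refl
sub-sub s s' zero    = refl
sub-sub s s' S       = refl
sub-sub s s' (If ρ)  = refl
sub-sub s s' (Rec ρ) = refl
sub-sub s s' (lam t) = cong lam (trans (sub-sub (exts s) (exts s') t) (sub-cong exts-exts t))
  where
  exts-exts : (λ x → sub (exts s) (exts s' x)) ≡ˢ exts (λ x → sub s (s' x))
  exts-exts here      = refl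
  exts-exts (there x) = sub-exts-wk s (s' x)
sub-sub s s' (t · u) = cong₂ _·_ (sub-sub s s' t) (sub-sub s s' u)

exts-id : ∀ {Γ σ} → exts {Γ} {σ = σ} idSub ≡ˢ idSub
exts-id here      = refl
exts-id (there x) = refl

sub-id : ∀ {Γ ρ} (t : Tm Γ ρ) → sub idSub t ≡ t
sub-id (var x) = refl
sub-id true    = refl
sub-id false   = refl
sub-id zero    = refl
sub-id S       = refl
sub-id (If ρ)  = refl
sub-id (Rec ρ) = refl
sub-id (lam t) = cong lam (trans (sub-cong exts-id t) (sub-id t))
sub-id (t · u) = cong₂ _·_ (sub-id t) (sub-id u)

ren-as-sub : ∀ {Γ Δ ρ} (r : Ren Γ Δ) (t : Tm Γ ρ) → ren r t ≡ sub (λ x → var (r x)) t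
ren-as-sub r t = trans (cong (ren r) (sym (sub-id t))) (ren-sub r idSub t)

ren-id : ∀ {Γ ρ} (t : Tm Γ ρ) → ren (λ x → x) t ≡ t
ren-id t = trans (ren-as-sub (λ x → x) t) (sub-id t)

exts-[] : ∀ {Γ Δ σ ρ} (s : Sub Γ Δ) (u : Tm Δ σ) (t : Tm (σ ∷ Γ) ρ) →
          sub (exts s) t [ u ] ≡ sub (u • s) t
exts-[] s u t = trans (sub-sub (u • idSub) (exts s) t) (sub-cong •-exts t)
  where
  •-exts : (λ x → sub (u • idSub) (exts s x)) ≡ˢ u • s
  •-exts here      = refl
  •-exts (there x) = trans (sub-ren (u • idSub) there (s x)) (sub-id (s x))

≡⇒≈ : ∀ {Γ ρ} {t u : Tm Γ ρ} → t ≡ u → t ≈ u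
≡⇒≈ refl = refl≈

ren-↦ : ∀ {Γ Δ ρ} (r : Ren Γ Δ) {t u : Tm Γ ρ} → t ↦ u → ren r t ≈ ren r u
ren-↦ r (β t u) = trans≈ (step (β _ _)) (≡⇒≈ (trans (sub-ren _ (ext r) t)
                     (trans (sub-cong •-ext t) (sym (ren-sub r (u • idSub) t)))))
  where
  •-ext : (λ x → (ren r u • idSub) (ext r x)) ≡ˢ (λ x → ren r ((u • idSub) x))
  •-ext here      = refl
  •-ext (there x) = refl
ren-↦ r (ifT s t)    = step (ifT _ _)
ren-↦ r (ifF s t)    = step (ifF _ _)
ren-↦ r (rec0 s f)   = step (rec0 _ _)
ren-↦ r (recS n s f) = step (recS _ _ _)

ren-≈ : ∀ {Γ Δ ρ} (r : Ren Γ Δ) {t u : Tm Γ ρ} → t ≈ u → ren r t ≈ ren r u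
ren-≈ r (step x)       = ren-↦ r x
ren-≈ r refl≈          = refl≈
ren-≈ r (sym≈ h)       = sym≈ (ren-≈ r h)
ren-≈ r (trans≈ h h')  = trans≈ (ren-≈ r h) (ren-≈ r h')
ren-≈ r (app≈ h h')    = app≈ (ren-≈ r h) (ren-≈ r h')
ren-≈ r (lam≈ h)       = lam≈ (ren-≈ (ext r) h)

sub-cong-≈ : ∀ {Γ Δ ρ} {s s' : Sub Γ Δ} → s ≈ˢ s' → (t : Tm Γ ρ) → sub s t ≈ sub s' t
sub-cong-≈ h (var x) = h x
sub-cong-≈ h true    = refl≈
sub-cong-≈ h false   = refl≈
sub-cong-≈ h zero    = refl≈
sub-cong-≈ h S       = refl≈
sub-cong-≈ h (If ρ)  = refl≈
sub-cong-≈ h (Rec ρ) = refl≈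
sub-cong-≈ {s = s} {s'} h (lam t) = lam≈ (sub-cong-≈ exts-≈ t)
  where
  exts-≈ : exts s ≈ˢ exts s'
  exts-≈ here      = refl≈
  exts-≈ (there x) = ren-≈ there (h x)
sub-cong-≈ h (t · u) = app≈ (sub-cong-≈ h t) (sub-cong-≈ h u)

appᵗ-congˡ : ∀ {Δ τ xs} {f f' : Tm Δ (xs ⇛ τ)} (as : Tms Δ xs) → f ≈ f' → appᵗ f as ≈ appᵗ f' as
appᵗ-congˡ []ᵗ       h = h
appᵗ-congˡ (a ∷ᵗ as) h = appᵗ-congˡ as (app≈ h refl≈)

subF-cong : ∀ {Γ Δ} {s s' : Sub Γ Δ} → s ≡ˢ s' → (A : Fm Γ) → subF s A ≡ subF s' A
subF-cong h (at t)   = cong at (sub-cong h t)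
subF-cong h (A ⊃ B)  = cong₂ _⊃_ (subF-cong h A) (subF-cong h B)
subF-cong h (A ∧ B)  = cong₂ _∧_ (subF-cong h A) (subF-cong h B)
subF-cong h (∀' ρ A) = cong (∀' ρ) (subF-cong (exts-cong h) A)

subF-subF : ∀ {Γ Δ Θ} (s : Sub Δ Θ) (s' : Sub Γ Δ) (A : Fm Γ) →
            subF s (subF s' A) ≡ subF (λ x → sub s (s' x)) A
subF-subF s s' (at t)   = cong at (sub-sub s s' t)
subF-subF s s' (A ⊃ B)  = cong₂ _⊃_ (subF-subF s s' A) (subF-subF s s' B)
subF-subF s s' (A ∧ B)  = cong₂ _∧_ (subF-subF s s' A) (subF-subF s s' B)
subF-subF s s' (∀' ρ A) =
  cong (∀' ρ) (trans (subF-subF (exts s) (exts s') A) (subF-cong exts-exts A))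
  where
  exts-exts : (λ x → sub (exts s) (exts s' x)) ≡ˢ exts (λ x → sub s (s' x))
  exts-exts here      = refl
  exts-exts (there x) = sub-exts-wk s (s' x)

subF-id : ∀ {Γ} (A : Fm Γ) → subF idSub A ≡ A
subF-id (at t)   = cong at (sub-id t)
subF-id (A ⊃ B)  = cong₂ _⊃_ (subF-id A) (subF-id B)
subF-id (A ∧ B)  = cong₂ _∧_ (subF-id A) (subF-id B)
subF-id (∀' ρ A) = cong (∀' ρ) (trans (subF-cong exts-id A) (subF-id A))

subᵗ : ∀ {Δ Δ' xs} → Sub Δ Δ' → Tms Δ xs → Tms Δ' xs
subᵗ s []ᵗ       = []ᵗ
subᵗ s (t ∷ᵗ ts) = sub s t ∷ᵗ subᵗ s ts

infix 4 _≈ᵗ_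
_≈ᵗ_ : ∀ {Δ xs} → Tms Δ xs → Tms Δ xs → Set
[]ᵗ       ≈ᵗ []ᵗ       = ⊤
(t ∷ᵗ ts) ≈ᵗ (u ∷ᵗ us) = t ≈ u × ts ≈ᵗ us

≈ᵗ-refl : ∀ {Δ xs} {ts : Tms Δ xs} → ts ≈ᵗ ts
≈ᵗ-refl {ts = []ᵗ}     = tt
≈ᵗ-refl {ts = t ∷ᵗ ts} = refl≈ , ≈ᵗ-refl

≈ᵗ-sym : ∀ {Δ xs} {ts us : Tms Δ xs} → ts ≈ᵗ us → us ≈ᵗ ts
≈ᵗ-sym {ts = []ᵗ}     {[]ᵗ}     h        = tt
≈ᵗ-sym {ts = t ∷ᵗ ts} {u ∷ᵗ us} (h , hs) = sym≈ h , ≈ᵗ-sym hs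

≡⇒≈ᵗ : ∀ {Δ xs} {ts us : Tms Δ xs} → ts ≡ us → ts ≈ᵗ us
≡⇒≈ᵗ refl = ≈ᵗ-refl

subᵗ-id : ∀ {Δ xs} (ts : Tms Δ xs) → subᵗ idSub ts ≡ ts
subᵗ-id []ᵗ       = refl
subᵗ-id (t ∷ᵗ ts) = cong₂ _∷ᵗ_ (sub-id t) (subᵗ-id ts)

subᵗ-ren : ∀ {Γ Δ Θ xs} (s : Sub Δ Θ) (r : Ren Γ Δ) (ts : Tms Γ xs) →
           subᵗ s (renᵗ r ts) ≡ subᵗ (λ x → s (r x)) ts
subᵗ-ren s r []ᵗ       = refl
subᵗ-ren s r (t ∷ᵗ ts) = cong₂ _∷ᵗ_ (sub-ren s r t) (subᵗ-ren s r ts)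

renᵗ-as-subᵗ : ∀ {Γ Δ xs} (r : Ren Γ Δ) (ts : Tms Γ xs) → renᵗ r ts ≡ subᵗ (λ x → var (r x)) ts
renᵗ-as-subᵗ r []ᵗ       = refl
renᵗ-as-subᵗ r (t ∷ᵗ ts) = cong₂ _∷ᵗ_ (ren-as-sub r t) (renᵗ-as-subᵗ r ts)

renᵗ-id : ∀ {Γ xs} (ts : Tms Γ xs) → renᵗ (λ x → x) ts ≡ ts
renᵗ-id []ᵗ       = refl
renᵗ-id (t ∷ᵗ ts) = cong₂ _∷ᵗ_ (ren-id t) (renᵗ-id ts)

renᵗ-++ᵗ : ∀ {Γ Δ xs ys} (r : Ren Γ Δ) (as : Tms Γ xs) (bs : Tms Γ ys) →
           renᵗ r (as ++ᵗ bs) ≡ renᵗ r as ++ᵗ renᵗ r bs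
renᵗ-++ᵗ r []ᵗ       bs = refl
renᵗ-++ᵗ r (a ∷ᵗ as) bs = cong (ren r a ∷ᵗ_) (renᵗ-++ᵗ r as bs)

ren-appᵗ : ∀ {Γ Δ τ xs} (r : Ren Γ Δ) (f : Tm Γ (xs ⇛ τ)) (as : Tms Γ xs) →
           ren r (appᵗ f as) ≡ appᵗ (ren r f) (renᵗ r as)
ren-appᵗ r f []ᵗ       = refl
ren-appᵗ r f (a ∷ᵗ as) = ren-appᵗ r (f · a) as

renᵗ-appsᵗ : ∀ {Γ Δ xs} (r : Ren Γ Δ) ys (fs : Tms Γ (map (xs ⇛_) ys)) (as : Tms Γ xs) →
             renᵗ r (appsᵗ ys fs as) ≡ appsᵗ ys (renᵗ r fs) (renᵗ r as)
renᵗ-appsᵗ r []       []ᵗ       as = refl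
renᵗ-appsᵗ r (y ∷ ys) (f ∷ᵗ fs) as = cong₂ _∷ᵗ_ (ren-appᵗ r f as) (renᵗ-appsᵗ r ys fs as)

splitᵗ-++ᵗ : ∀ {Δ} xs {ys} (as : Tms Δ xs) (bs : Tms Δ ys) → splitᵗ xs (as ++ᵗ bs) ≡ (as , bs)
splitᵗ-++ᵗ []       []ᵗ       bs = refl
splitᵗ-++ᵗ (x ∷ xs) (a ∷ᵗ as) bs rewrite splitᵗ-++ᵗ xs as bs = refl

splitᵗ-join : ∀ {Δ} xs {ys} (ts : Tms Δ (xs ++ ys)) →
              proj₁ (splitᵗ xs ts) ++ᵗ proj₂ (splitᵗ xs ts) ≡ ts
splitᵗ-join []       ts = refl
splitᵗ-join (x ∷ xs) (t ∷ᵗ ts) with splitᵗ xs ts | splitᵗ-join xs ts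
... | us , vs | ih = cong (t ∷ᵗ_) ih

split₁-sub≈ : ∀ {Δ Δ'} xs {ys} {τ : Sub Δ Δ'} {ts : Tms Δ (xs ++ ys)} {ts' : Tms Δ' (xs ++ ys)} →
              subᵗ τ ts ≈ᵗ ts' → subᵗ τ (proj₁ (splitᵗ xs ts)) ≈ᵗ proj₁ (splitᵗ xs ts')
split₁-sub≈ []       h = tt
split₁-sub≈ (x ∷ xs) {ts = t ∷ᵗ ts} {t' ∷ᵗ ts'} (h , hs)
  with splitᵗ xs ts | splitᵗ xs ts' | split₁-sub≈ xs {ts = ts} {ts'} hs
... | _ , _ | _ , _ | ih = h , ih

split₂-sub≈ : ∀ {Δ Δ'} xs {ys} {τ : Sub Δ Δ'} {ts : Tms Δ (xs ++ ys)} {ts' : Tms Δ' (xs ++ ys)} →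
              subᵗ τ ts ≈ᵗ ts' → subᵗ τ (proj₂ (splitᵗ xs ts)) ≈ᵗ proj₂ (splitᵗ xs ts')
split₂-sub≈ []       h = h
split₂-sub≈ (x ∷ xs) {ts = t ∷ᵗ ts} {t' ∷ᵗ ts'} (h , hs)
  with splitᵗ xs ts | splitᵗ xs ts' | split₂-sub≈ xs {ts = ts} {ts'} hs
... | _ , _ | _ , _ | ih = ih

++ᵗ-sub≈ : ∀ {Δ Δ' xs ys} {τ : Sub Δ Δ'} {as : Tms Δ xs} {as'} {bs : Tms Δ ys} {bs'} →
           subᵗ τ as ≈ᵗ as' → subᵗ τ bs ≈ᵗ bs' → subᵗ τ (as ++ᵗ bs) ≈ᵗ as' ++ᵗ bs'
++ᵗ-sub≈ {as = []ᵗ}     {[]ᵗ}       h        h' = h'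
++ᵗ-sub≈ {as = a ∷ᵗ as} {a' ∷ᵗ as'} (h , hs) h' = h , ++ᵗ-sub≈ hs h'

appᵗ-sub≈ : ∀ {Δ Δ' τ' xs} {τ : Sub Δ Δ'} {f : Tm Δ (xs ⇛ τ')} {f'} {as : Tms Δ xs} {as'} →
            sub τ f ≈ f' → subᵗ τ as ≈ᵗ as' → sub τ (appᵗ f as) ≈ appᵗ f' as'
appᵗ-sub≈ {as = []ᵗ}     {[]ᵗ}       hf h        = hf
appᵗ-sub≈ {as = a ∷ᵗ as} {a' ∷ᵗ as'} hf (h , hs) = appᵗ-sub≈ {as = as} (app≈ hf h) hs

appsᵗ-sub≈ : ∀ {Δ Δ' xs} ys {τ : Sub Δ Δ'} {fs : Tms Δ (map (xs ⇛_) ys)} {fs'} {as : Tms Δ xs} {as'} →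
             subᵗ τ fs ≈ᵗ fs' → subᵗ τ as ≈ᵗ as' → subᵗ τ (appsᵗ ys fs as) ≈ᵗ appsᵗ ys fs' as'
appsᵗ-sub≈ []       {fs = []ᵗ}     {[]ᵗ}       hf         h = tt
appsᵗ-sub≈ (y ∷ ys) {fs = f ∷ᵗ fs} {f' ∷ᵗ fs'} {as} (hf , hfs) h =
  appᵗ-sub≈ {as = as} hf h , appsᵗ-sub≈ ys hfs h

app1ᵗ-sub≈ : ∀ {Δ Δ' ρ} ys {τ : Sub Δ Δ'} {fs : Tms Δ (map (ρ ⇒_) ys)} {fs'} {a : Tm Δ ρ} {a'} →
             subᵗ τ fs ≈ᵗ fs' → sub τ a ≈ a' → subᵗ τ (app1ᵗ ys fs a) ≈ᵗ app1ᵗ ys fs' a'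
app1ᵗ-sub≈ []       {fs = []ᵗ}     {[]ᵗ}       hf         h = tt
app1ᵗ-sub≈ (y ∷ ys) {fs = f ∷ᵗ fs} {f' ∷ᵗ fs'} (hf , hfs) h = app≈ hf h , app1ᵗ-sub≈ ys hfs h

-- The translation under substitution and conversion

exts* : ∀ {Δ Δ'} (cs : List Ty) → Sub Δ Δ' → Sub (cs ++ Δ) (cs ++ Δ')
exts* []       τ = τ
exts* (c ∷ cs) τ = exts (exts* cs τ)

infixr 5 _++ˢ_
_++ˢ_ : ∀ {Δ Γ cs} → Tms Δ cs → Sub Γ Δ → Sub (cs ++ Γ) Δ
[]ᵗ       ++ˢ s = s
(t ∷ᵗ ts) ++ˢ s = t • (ts ++ˢ s)

exts*-wk* : ∀ {Δ Δ'} (cs : List Ty) (τ : Sub Δ Δ') {ρ} (x : Δ ∋ ρ) →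
            exts* cs τ (wk* cs x) ≡ ren (wk* cs) (τ x)
exts*-wk* []       τ x = sym (ren-id (τ x))
exts*-wk* (c ∷ cs) τ x = trans (cong wk (exts*-wk* cs τ x)) (ren-ren there (wk* cs) (τ x))

sub-exts*-wk* : ∀ {Δ Δ' ρ} (cs : List Ty) (τ : Sub Δ Δ') (t : Tm Δ ρ) →
                sub (exts* cs τ) (ren (wk* cs) t) ≡ ren (wk* cs) (sub τ t)
sub-exts*-wk* cs τ t = trans (sub-ren (exts* cs τ) (wk* cs) t)
                         (trans (sub-cong (exts*-wk* cs τ) t) (sym (ren-sub (wk* cs) τ t)))

subᵗ-exts-wk : ∀ {Δ Δ' σ xs} (τ : Sub Δ Δ') (vs : Tms Δ xs) →
               subᵗ (exts {σ = σ} τ) (renᵗ there vs) ≡ renᵗ there (subᵗ τ vs)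
subᵗ-exts-wk τ []ᵗ       = refl
subᵗ-exts-wk τ (v ∷ᵗ vs) = cong₂ _∷ᵗ_ (sub-exts-wk τ v) (subᵗ-exts-wk τ vs)

exts*-varsᵗ : ∀ {Δ Δ'} (cs : List Ty) (τ : Sub Δ Δ') → subᵗ (exts* cs τ) (varsᵗ cs) ≡ varsᵗ cs
exts*-varsᵗ []       τ = refl
exts*-varsᵗ (c ∷ cs) τ = cong (var here ∷ᵗ_)
  (trans (subᵗ-exts-wk (exts* cs τ) (varsᵗ cs)) (cong (renᵗ there) (exts*-varsᵗ cs τ)))

++ˢ-wk* : ∀ {Δ Γ} (cs : List Ty) (ts : Tms Δ cs) (s : Sub Γ Δ) {ρ} (x : Γ ∋ ρ) →
          (ts ++ˢ s) (wk* cs x) ≡ s x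
++ˢ-wk* []       []ᵗ       s x = refl
++ˢ-wk* (c ∷ cs) (t ∷ᵗ ts) s x = ++ˢ-wk* cs ts s x

++ˢ-varsᵗ : ∀ {Δ Γ} (cs : List Ty) (ts : Tms Δ cs) (s : Sub Γ Δ) → subᵗ (ts ++ˢ s) (varsᵗ cs) ≡ ts
++ˢ-varsᵗ []       []ᵗ       s = refl
++ˢ-varsᵗ (c ∷ cs) (t ∷ᵗ ts) s =
  cong (t ∷ᵗ_) (trans (subᵗ-ren (t • (ts ++ˢ s)) there (varsᵗ cs)) (++ˢ-varsᵗ cs ts s))

sub-++ˢ-wk* : ∀ {Δ Γ ρ} (cs : List Ty) (ts : Tms Δ cs) (s : Sub Γ Δ) (t : Tm Γ ρ) →
              sub (ts ++ˢ s) (ren (wk* cs) t) ≡ sub s t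
sub-++ˢ-wk* cs ts s t = trans (sub-ren (ts ++ˢ s) (wk* cs) t) (sub-cong (++ˢ-wk* cs ts s) t)

subᵗ-++ˢ-wk* : ∀ {Δ Γ xs} (cs : List Ty) (ts : Tms Δ cs) (s : Sub Γ Δ) (us : Tms Γ xs) →
               subᵗ (ts ++ˢ s) (renᵗ (wk* cs) us) ≡ subᵗ s us
subᵗ-++ˢ-wk* cs ts s []ᵗ       = refl
subᵗ-++ˢ-wk* cs ts s (u ∷ᵗ us) = cong₂ _∷ᵗ_ (sub-++ˢ-wk* cs ts s u) (subᵗ-++ˢ-wk* cs ts s us)

renᵗ-wk*-sub≈ : ∀ {Δ Δ' xs} (cs : List Ty) {τ : Sub Δ Δ'} {ts : Tms Δ xs} {ts'} →
                subᵗ τ ts ≈ᵗ ts' → subᵗ (exts* cs τ) (renᵗ (wk* cs) ts) ≈ᵗ renᵗ (wk* cs) ts'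
renᵗ-wk*-sub≈ cs {ts = []ᵗ}           {[]ᵗ}       h        = tt
renᵗ-wk*-sub≈ cs {τ = τ} {t ∷ᵗ ts} {t' ∷ᵗ ts'} (h , hs) =
  trans≈ (≡⇒≈ (sub-exts*-wk* cs τ t)) (ren-≈ (wk* cs) h) , renᵗ-wk*-sub≈ cs hs

renᵗ-there-sub≈ : ∀ {Δ Δ' xs σ} {τ : Sub Δ Δ'} {ts : Tms Δ xs} {ts'} →
                  subᵗ τ ts ≈ᵗ ts' → subᵗ (exts {σ = σ} τ) (renᵗ there ts) ≈ᵗ renᵗ there ts'
renᵗ-there-sub≈ {ts = []ᵗ}           {[]ᵗ}       h        = tt
renᵗ-there-sub≈ {τ = τ} {t ∷ᵗ ts} {t' ∷ᵗ ts'} (h , hs) =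
  trans≈ (≡⇒≈ (sub-exts-wk τ t)) (ren-≈ there h) , renᵗ-there-sub≈ hs

subF-∀* : ∀ {Δ Δ'} (cs : List Ty) (τ : Sub Δ Δ') (F : Fm (cs ++ Δ)) →
          subF τ (∀* cs F) ≡ ∀* cs (subF (exts* cs τ) F)
subF-∀* []       τ F = refl
subF-∀* (c ∷ cs) τ F = subF-∀* cs τ (∀' c F)

∀*-cong : ∀ {Δ} (cs : List Ty) {F G : Fm (cs ++ Δ)} → F ≈F G → ∀* cs F ≈F ∀* cs G
∀*-cong []       h = h
∀*-cong (c ∷ cs) h = ∀*-cong cs (∀≈ h)

∣⊃∣-unfold : ∀ {l Γ Δ} (A B : MFm l Γ) (σ : Sub Γ Δ) fgs xvs →
  let fs , gs = splitᵗ (map ((Wt A ++ Ch B) ⇛_) (Ch A)) fgs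
      xs , vs = splitᵗ (Wt A) xvs
  in ∣ A ⊃ₘ B ∣ σ fgs xvs ≡
     (∣ A ∣ σ xs (appsᵗ (Ch A) fs (xs ++ᵗ vs)) ⊃ ∣ B ∣ σ (appsᵗ (Wt B) gs xs) vs)
∣⊃∣-unfold A B σ fgs xvs with splitᵗ (map ((Wt A ++ Ch B) ⇛_) (Ch A)) fgs | splitᵗ (Wt A) xvs
... | fs , gs | xs , vs = refl

∣∧∣-unfold : ∀ {l Γ Δ} (A B : MFm l Γ) (σ : Sub Γ Δ) xus yvs →
  let xs , us = splitᵗ (Wt A) xus
      ys , vs = splitᵗ (Ch A) yvs
  in ∣ A ∧ₘ B ∣ σ xus yvs ≡ (∣ A ∣ σ xs ys ∧ ∣ B ∣ σ us vs)
∣∧∣-unfold A B σ xus yvs with splitᵗ (Wt A) xus | splitᵗ (Ch A) yvs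
... | xs , us | ys , vs = refl

∣⊃∣-++ : ∀ {l Γ Δ} (A B : MFm l Γ) (σ : Sub Γ Δ) fs gs xs vs →
  ∣ A ⊃ₘ B ∣ σ (fs ++ᵗ gs) (xs ++ᵗ vs) ≡
  (∣ A ∣ σ xs (appsᵗ (Ch A) fs (xs ++ᵗ vs)) ⊃ ∣ B ∣ σ (appsᵗ (Wt B) gs xs) vs)
∣⊃∣-++ A B σ fs gs xs vs
  rewrite splitᵗ-++ᵗ (map ((Wt A ++ Ch B) ⇛_) (Ch A)) fs gs | splitᵗ-++ᵗ (Wt A) xs vs = refl

∣∧∣-++ : ∀ {l Γ Δ} (A B : MFm l Γ) (σ : Sub Γ Δ) xs us ys vs →
  ∣ A ∧ₘ B ∣ σ (xs ++ᵗ us) (ys ++ᵗ vs) ≡ (∣ A ∣ σ xs ys ∧ ∣ B ∣ σ us vs)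
∣∧∣-++ A B σ xs us ys vs rewrite splitᵗ-++ᵗ (Wt A) xs us | splitᵗ-++ᵗ (Ch A) ys vs = refl

∣¬∣-++ : ∀ {l Γ Δ} (A : MFm l Γ) (σ : Sub Γ Δ) fs xs →
  ∣ ¬ₘ A ∣ σ fs (xs ++ᵗ []ᵗ) ≡
  (∣ A ∣ σ xs (appsᵗ (Ch A) (proj₁ (splitᵗ (map ((Wt A ++ []) ⇛_) (Ch A)) fs)) (xs ++ᵗ []ᵗ)) ⊃ ⊥F)
∣¬∣-++ A σ fs xs rewrite ∣⊃∣-unfold A (atₘ false) σ fs (xs ++ᵗ []ᵗ) | splitᵗ-++ᵗ (Wt A) xs []ᵗ = refl

∣◇∣-unfold : ∀ {l Γ Δ} (A : MFm l Γ) (σ : Sub Γ Δ) hs →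
             ∣ ◇ A ∣ σ []ᵗ hs ≡ (∣ □ (¬ₘ A) ∣ σ (proj₁ (splitᵗ (Wt (¬ₘ A)) hs)) []ᵗ ⊃ ⊥F)
∣◇∣-unfold A σ hs = ∣⊃∣-unfold (□ (¬ₘ A)) (atₘ false) σ []ᵗ hs

•-sub≈ : ∀ {Γ Δ Δ' ρ} {τ : Sub Δ Δ'} {σ : Sub Γ Δ} {σ' : Sub Γ Δ'} {u : Tm Δ ρ} {u'} →
         sub τ u ≈ u' → (λ x → sub τ (σ x)) ≈ˢ σ' → (λ x → sub τ ((u • σ) x)) ≈ˢ u' • σ'
•-sub≈ hu hσ here      = hu
•-sub≈ hu hσ (there x) = hσ x

exts-sub≈ : ∀ {Γ Δ Δ' ρ} {τ : Sub Δ Δ'} {σ : Sub Γ Δ} {σ' : Sub Γ Δ'} →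
            (λ x → sub τ (σ x)) ≈ˢ σ' → (λ x → sub (exts {σ = ρ} τ) (exts σ x)) ≈ˢ exts σ'
exts-sub≈ hσ here = refl≈
exts-sub≈ {τ = τ} {σ} hσ (there x) = trans≈ (≡⇒≈ (sub-exts-wk τ (σ x))) (ren-≈ there (hσ x))

∣∣-sub≈ : ∀ {l Γ Δ Δ'} (A : MFm l Γ) (τ : Sub Δ Δ') {σ : Sub Γ Δ} {σ' : Sub Γ Δ'}
          {xs : Tms Δ (Wt A)} {xs' : Tms Δ' (Wt A)} {ys : Tms Δ (Ch A)} {ys' : Tms Δ' (Ch A)} →
          (λ x → sub τ (σ x)) ≈ˢ σ' → subᵗ τ xs ≈ᵗ xs' → subᵗ τ ys ≈ᵗ ys' →
          subF τ (∣ A ∣ σ xs ys) ≈F ∣ A ∣ σ' xs' ys'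
∣∣-sub≈ (atₘ t) τ {σ} hσ hx hy = at≈ (trans≈ (≡⇒≈ (sub-sub τ σ t)) (sub-cong-≈ hσ t))
∣∣-sub≈ (A ⊃ₘ B) τ {σ} {σ'} {fgs} {fgs'} {xvs} {xvs'} hσ hx hy
  rewrite ∣⊃∣-unfold A B σ fgs xvs | ∣⊃∣-unfold A B σ' fgs' xvs' =
  ⊃≈ (∣∣-sub≈ A τ hσ hxs (appsᵗ-sub≈ (Ch A) (split₁-sub≈ MA hx) (++ᵗ-sub≈ hxs (split₂-sub≈ (Wt A) hy))))
     (∣∣-sub≈ B τ hσ (appsᵗ-sub≈ (Wt B) (split₂-sub≈ MA hx) hxs) (split₂-sub≈ (Wt A) hy))
  where
  MA = map ((Wt A ++ Ch B) ⇛_) (Ch A)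
  hxs = split₁-sub≈ (Wt A) hy
∣∣-sub≈ (A ∧ₘ B) τ {σ} {σ'} {xus} {xus'} {yvs} {yvs'} hσ hx hy
  rewrite ∣∧∣-unfold A B σ xus yvs | ∣∧∣-unfold A B σ' xus' yvs' =
  ∧≈ (∣∣-sub≈ A τ hσ (split₁-sub≈ (Wt A) hx) (split₁-sub≈ (Ch A) hy))
     (∣∣-sub≈ B τ hσ (split₂-sub≈ (Wt A) hx) (split₂-sub≈ (Ch A) hy))
∣∣-sub≈ (∀ₘ ρ A) τ {ys = z ∷ᵗ ys} {z' ∷ᵗ ys'} hσ hx (hz , hy) =
  ∣∣-sub≈ A τ (•-sub≈ hz hσ) (app1ᵗ-sub≈ (Wt A) hx hz) hy
∣∣-sub≈ (□ A) τ {σ} {σ'} hσ hx hy =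
  subst (_≈F _) (sym (subF-∀* (Ch A) τ _))
    (∀*-cong (Ch A) (∣∣-sub≈ A (exts* (Ch A) τ) hσ* (renᵗ-wk*-sub≈ (Ch A) hx)
                                (≡⇒≈ᵗ (exts*-varsᵗ (Ch A) τ))))
  where
  hσ* : (λ x → sub (exts* (Ch A) τ) (ren (wk* (Ch A)) (σ x))) ≈ˢ (λ x → ren (wk* (Ch A)) (σ' x))
  hσ* x = trans≈ (≡⇒≈ (sub-exts*-wk* (Ch A) τ (σ x))) (ren-≈ (wk* (Ch A)) (hσ x))
∣∣-sub≈ (∀⁺ ρ A) τ hσ hx hy =
  ∀≈ (∣∣-sub≈ A (exts τ) (exts-sub≈ hσ) (app1ᵗ-sub≈ (Wt A) (renᵗ-there-sub≈ hx) refl≈)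
                (renᵗ-there-sub≈ hy))
∣∣-sub≈ (∀⁻ ρ A) τ {ys = z ∷ᵗ ys} {z' ∷ᵗ ys'} hσ hx (hz , hy) = ∣∣-sub≈ A τ (•-sub≈ hz hσ) hx hy
∣∣-sub≈ (∀ⁿᶜ ρ A) τ hσ hx hy =
  ∀≈ (∣∣-sub≈ A (exts τ) (exts-sub≈ hσ) (renᵗ-there-sub≈ hx) (renᵗ-there-sub≈ hy))

∣∣-cong : ∀ {l Γ Δ} (A : MFm l Γ) {σ σ' : Sub Γ Δ} {xs xs' : Tms Δ (Wt A)} {ys ys' : Tms Δ (Ch A)} →
          σ ≈ˢ σ' → xs ≈ᵗ xs' → ys ≈ᵗ ys' → ∣ A ∣ σ xs ys ≈F ∣ A ∣ σ' xs' ys'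
∣∣-cong A {σ} {xs = xs} {ys = ys} hσ hx hy =
  subst (_≈F _) (subF-id _)
    (∣∣-sub≈ A idSub (λ x → trans≈ (≡⇒≈ (sub-id (σ x))) (hσ x))
       (subst (_≈ᵗ _) (sym (subᵗ-id xs)) hx) (subst (_≈ᵗ _) (sym (subᵗ-id ys)) hy))

∀*E : ∀ {Δ Φ} (cs : List Ty) {F : Fm (cs ++ Δ)} → Der Δ Φ (∀* cs F) → (ts : Tms Δ cs) →
      Der Δ Φ (subF (ts ++ˢ idSub) F)
∀*E []       {F} d []ᵗ = subst (Der _ _) (sym (subF-id F)) d
∀*E (c ∷ cs) {F} d (t ∷ᵗ ts) =
  subst (Der _ _) (trans (subF-subF (t • idSub) (exts (ts ++ˢ idSub)) F) (subF-cong •-exts F))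
    (∀E (∀*E cs d ts) t)
  where
  •-exts : (λ x → sub (t • idSub) (exts (ts ++ˢ idSub) x)) ≡ˢ t • (ts ++ˢ idSub)
  •-exts here      = refl
  •-exts (there x) = trans (sub-ren (t • idSub) there ((ts ++ˢ idSub) x)) (sub-id _)

renF-wk*-[] : ∀ {Δ} (Φ : List (Fm Δ)) → map (renF (wk* [])) Φ ≡ Φ
renF-wk*-[] []      = refl
renF-wk*-[] (A ∷ Φ) = cong₂ _∷_ (subF-id A) (renF-wk*-[] Φ)

renF-wk*-∷ : ∀ {Δ} c (cs : List Ty) (Φ : List (Fm Δ)) →
             map (renF (wk* (c ∷ cs))) Φ ≡ map wkF (map (renF (wk* cs)) Φ)
renF-wk*-∷ c cs []      = refl
renF-wk*-∷ c cs (A ∷ Φ) =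
  cong₂ _∷_ (sym (subF-subF (λ x → var (there x)) (λ x → var (wk* cs x)) A)) (renF-wk*-∷ c cs Φ)

∀*I : ∀ {Δ} (cs : List Ty) {Φ : List (Fm Δ)} {F : Fm (cs ++ Δ)} →
      Der (cs ++ Δ) (map (renF (wk* cs)) Φ) F → Der Δ Φ (∀* cs F)
∀*I []       {Φ} {F} d = subst (λ Ψ → Der _ Ψ F) (renF-wk*-[] Φ) d
∀*I (c ∷ cs) {Φ} {F} d = ∀*I cs (∀I (subst (λ Ψ → Der _ Ψ F) (renF-wk*-∷ c cs Φ) d))

□-inst : ∀ {l Γ Δ Φ} (A : MFm l Γ) {σ : Sub Γ Δ} {xs : Tms Δ (Wt A)} →
         Der Δ Φ (∣ □ A ∣ σ xs []ᵗ) → (ys : Tms Δ (Ch A)) → Der Δ Φ (∣ A ∣ σ xs ys)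
□-inst A {σ} {xs} d ys =
  conv (∀*E (Ch A) d ys)
    (∣∣-sub≈ A (ys ++ˢ idSub)
       (λ x → ≡⇒≈ (trans (sub-++ˢ-wk* (Ch A) ys idSub (σ x)) (sub-id (σ x))))
       (≡⇒≈ᵗ (trans (subᵗ-++ˢ-wk* (Ch A) ys idSub xs) (subᵗ-id xs)))
       (≡⇒≈ᵗ (++ˢ-varsᵗ (Ch A) ys idSub)))

∣∣-renD : ∀ {l Γ Δ Δ' Φ} (A : MFm l Γ) (r : Ren Δ Δ') {σ : Sub Γ Δ} {xs : Tms Δ (Wt A)}
          {ys : Tms Δ (Ch A)} → Der Δ' Φ (renF r (∣ A ∣ σ xs ys)) →
          Der Δ' Φ (∣ A ∣ (λ x → ren r (σ x)) (renᵗ r xs) (renᵗ r ys))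
∣∣-renD A r {σ} {xs} {ys} d =
  conv d (∣∣-sub≈ A (λ x → var (r x)) (λ x → ≡⇒≈ (sym (ren-as-sub r (σ x))))
            (≡⇒≈ᵗ (sym (renᵗ-as-subᵗ r xs))) (≡⇒≈ᵗ (sym (renᵗ-as-subᵗ r ys))))

¬¬¬⇒¬ : ∀ {Δ Φ} {X : Fm Δ} → Der Δ Φ ((((X ⊃ ⊥F) ⊃ ⊥F) ⊃ ⊥F) ⊃ X ⊃ ⊥F)
¬¬¬⇒¬ = ⊃I (⊃I (⊃E (ass (there (here refl))) (⊃I (⊃E (ass (here refl)) (ass (there (here refl)))))))

-- Realizers as λ-abstractions

-- cs ⊕ Γ extends Γ by c₁ first, so the outermost λ of Λ cs binds c₁, as the order in cs ⇛ τ requires.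
infixr 5 _⊕_
_⊕_ : List Ty → Ctx → Ctx
[]       ⊕ Γ = Γ
(c ∷ cs) ⊕ Γ = cs ⊕ (c ∷ Γ)

Λ : ∀ {Γ τ} (cs : List Ty) → Tm (cs ⊕ Γ) τ → Tm Γ (cs ⇛ τ)
Λ []       t = t
Λ (c ∷ cs) t = lam (Λ cs t)

lamᵗ : ∀ {Γ} (cs ys : List Ty) → Tms (cs ⊕ Γ) ys → Tms Γ (map (cs ⇛_) ys)
lamᵗ cs []       []ᵗ       = []ᵗ
lamᵗ cs (y ∷ ys) (b ∷ᵗ bs) = Λ cs b ∷ᵗ lamᵗ cs ys bs

_⊛_ : ∀ {Γ Δ cs} → Tms Δ cs → Sub Γ Δ → Sub (cs ⊕ Γ) Δ
[]ᵗ       ⊛ s = s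
(u ∷ᵗ us) ⊛ s = us ⊛ (u • s)

wk⊕ : ∀ {Γ} (cs : List Ty) → Ren Γ (cs ⊕ Γ)
wk⊕ []       x = x
wk⊕ (c ∷ cs) x = wk⊕ cs (there x)

varsΛ : ∀ {Γ} (cs : List Ty) → Tms (cs ⊕ Γ) cs
varsΛ []       = []ᵗ
varsΛ (c ∷ cs) = var (wk⊕ cs here) ∷ᵗ varsΛ cs

⊛-wk⊕ : ∀ {Γ Δ} (cs : List Ty) (us : Tms Δ cs) (s : Sub Γ Δ) {ρ} (x : Γ ∋ ρ) →
        (us ⊛ s) (wk⊕ cs x) ≡ s x
⊛-wk⊕ []       []ᵗ       s x = refl
⊛-wk⊕ (c ∷ cs) (u ∷ᵗ us) s x = ⊛-wk⊕ cs us (u • s) (there x)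

⊛-varsΛ : ∀ {Γ Δ} (cs : List Ty) (us : Tms Δ cs) (s : Sub Γ Δ) → subᵗ (us ⊛ s) (varsΛ cs) ≡ us
⊛-varsΛ []       []ᵗ       s = refl
⊛-varsΛ (c ∷ cs) (u ∷ᵗ us) s = cong₂ _∷ᵗ_ (⊛-wk⊕ cs us (u • s) here) (⊛-varsΛ cs us (u • s))

Λ-β : ∀ {Γ Δ τ} (cs : List Ty) (s : Sub Γ Δ) (t : Tm (cs ⊕ Γ) τ) (us : Tms Δ cs) →
      appᵗ (sub s (Λ cs t)) us ≈ sub (us ⊛ s) t
Λ-β []       s t []ᵗ       = refl≈
Λ-β (c ∷ cs) s t (u ∷ᵗ us) =
  trans≈ (appᵗ-congˡ us (trans≈ (step (β _ _)) (≡⇒≈ (exts-[] s u (Λ cs t))))) (Λ-β cs (u • s) t us)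

lamᵗ-β : ∀ {Γ Δ} (cs ys : List Ty) (s : Sub Γ Δ) (bs : Tms (cs ⊕ Γ) ys) (us : Tms Δ cs) →
         appsᵗ ys (subᵗ s (lamᵗ cs ys bs)) us ≈ᵗ subᵗ (us ⊛ s) bs
lamᵗ-β cs []       s []ᵗ       us = tt
lamᵗ-β cs (y ∷ ys) s (b ∷ᵗ bs) us = Λ-β cs s b us , lamᵗ-β cs ys s bs us

renᵗ-lamᵗ-β : ∀ {Γ Δ} (cs ys : List Ty) (bs : Tms (cs ⊕ Γ) ys) (r : Ren Γ Δ) (us : Tms Δ cs) →
              appsᵗ ys (renᵗ r (lamᵗ cs ys bs)) us ≈ᵗ subᵗ (us ⊛ (λ x → var (r x))) bs
renᵗ-lamᵗ-β cs ys bs r us =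
  subst (λ P → appsᵗ ys P us ≈ᵗ subᵗ (us ⊛ (λ x → var (r x))) bs) (sym (renᵗ-as-subᵗ r (lamᵗ cs ys bs)))
    (lamᵗ-β cs ys (λ x → var (r x)) bs us)

fstΛ : ∀ {Γ} (cs ds : List Ty) → Tms ((cs ++ ds) ⊕ Γ) cs
fstΛ cs ds = proj₁ (splitᵗ cs (varsΛ (cs ++ ds)))

sndΛ : ∀ {Γ} (cs ds : List Ty) → Tms ((cs ++ ds) ⊕ Γ) ds
sndΛ cs ds = proj₂ (splitᵗ cs (varsΛ (cs ++ ds)))

⊛-fstΛ : ∀ {Γ Δ} cs ds (us : Tms Δ (cs ++ ds)) (σ : Sub Γ Δ) →
         subᵗ (us ⊛ σ) (fstΛ cs ds) ≈ᵗ proj₁ (splitᵗ cs us)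
⊛-fstΛ cs ds us σ = split₁-sub≈ cs (≡⇒≈ᵗ (⊛-varsΛ (cs ++ ds) us σ))

⊛-sndΛ : ∀ {Γ Δ} cs ds (us : Tms Δ (cs ++ ds)) (σ : Sub Γ Δ) →
         subᵗ (us ⊛ σ) (sndΛ cs ds) ≈ᵗ proj₂ (splitᵗ cs us)
⊛-sndΛ cs ds us σ = split₂-sub≈ cs (≡⇒≈ᵗ (⊛-varsΛ (cs ++ ds) us σ))

⊛-fstΛ-++ᵗ : ∀ {Γ Δ} cs ds (xs : Tms Δ cs) (vs : Tms Δ ds) (σ : Sub Γ Δ) →
             subᵗ ((xs ++ᵗ vs) ⊛ σ) (fstΛ cs ds) ≈ᵗ xs
⊛-fstΛ-++ᵗ cs ds xs vs σ =
  subst (subᵗ ((xs ++ᵗ vs) ⊛ σ) (fstΛ cs ds) ≈ᵗ_) (cong proj₁ (splitᵗ-++ᵗ cs xs vs))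
    (⊛-fstΛ cs ds (xs ++ᵗ vs) σ)

⊛-sndΛ-++ᵗ : ∀ {Γ Δ} cs ds (xs : Tms Δ cs) (vs : Tms Δ ds) (σ : Sub Γ Δ) →
             subᵗ ((xs ++ᵗ vs) ⊛ σ) (sndΛ cs ds) ≈ᵗ vs
⊛-sndΛ-++ᵗ cs ds xs vs σ =
  subst (subᵗ ((xs ++ᵗ vs) ⊛ σ) (sndΛ cs ds) ≈ᵗ_) (cong proj₂ (splitᵗ-++ᵗ cs xs vs))
    (⊛-sndΛ cs ds (xs ++ᵗ vs) σ)

-- F computes the challenge of A and G the witness of B; their β-reduction is done here once and for all.
realizable-⊃ : ∀ {l Γ} (A B : MFm l Γ)
  (F : Tms ((Wt A ++ Ch B) ⊕ Γ) (Ch A)) (G : Tms (Wt A ⊕ Γ) (Wt B)) →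
  (∀ {Δ} (σ : Sub Γ Δ) xs vs →
     Der Δ [] (∣ A ∣ σ xs (subᵗ ((xs ++ᵗ vs) ⊛ σ) F) ⊃ ∣ B ∣ σ (subᵗ (xs ⊛ σ) G) vs)) →
  Realizable (A ⊃ₘ B)
realizable-⊃ {Γ = Γ} A B F G d =
  Fλ ++ᵗ Gλ , subst (Der _ []) unfolded (conv (d θ xs vs) (⊃≈ F-β G-β))
  where
  CC = Wt A ++ Ch B
  Fλ = lamᵗ CC (Ch A) F
  Gλ = lamᵗ (Wt A) (Wt B) G
  θ : Sub Γ (CC ++ Γ)
  θ x = var (wk* CC x)
  V = varsᵗ CC
  xs = proj₁ (splitᵗ (Wt A) V)
  vs = proj₂ (splitᵗ (Wt A) V)
  F-β = ∣∣-cong A (λ _ → refl≈) ≈ᵗ-refl (≈ᵗ-sym (renᵗ-lamᵗ-β CC (Ch A) F (wk* CC) (xs ++ᵗ vs)))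
  G-β = ∣∣-cong B (λ _ → refl≈) (≈ᵗ-sym (renᵗ-lamᵗ-β (Wt A) (Wt B) G (wk* CC) xs)) ≈ᵗ-refl
  unfolded : (∣ A ∣ θ xs (appsᵗ (Ch A) (renᵗ (wk* CC) Fλ) (xs ++ᵗ vs))
                ⊃ ∣ B ∣ θ (appsᵗ (Wt B) (renᵗ (wk* CC) Gλ) xs) vs)
             ≡ ∣ A ⊃ₘ B ∣ θ (renᵗ (wk* CC) (Fλ ++ᵗ Gλ)) V
  unfolded = trans (sym (∣⊃∣-++ A B θ _ _ xs vs))
                   (cong₂ (∣ A ⊃ₘ B ∣ θ) (sym (renᵗ-++ᵗ (wk* CC) Fλ Gλ)) (splitᵗ-join (Wt A) V))

-- The S4 axioms

T-realizable : ∀ {l Γ} (A : MFm l Γ) → Realizable (□ A ⊃ₘ A)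
T-realizable A = realizable-⊃ (□ A) A []ᵗ (varsΛ (Wt A)) λ σ xs vs →
  ⊃I (conv (□-inst A (ass (here refl)) vs)
           (∣∣-cong A (λ _ → refl≈) (≡⇒≈ᵗ (sym (⊛-varsΛ (Wt A) xs σ))) ≈ᵗ-refl))

4-realizable : ∀ {l Γ} (A : MFm l Γ) → Realizable (□ A ⊃ₘ □ (□ A))
4-realizable A = realizable-⊃ (□ A) (□ (□ A)) []ᵗ (varsΛ (Wt A)) λ σ xs vs →
  ⊃I (conv (ass (here refl))
           (∣∣-cong (□ A) (λ x → ≡⇒≈ (sym (ren-id (σ x))))
              (≡⇒≈ᵗ (sym (trans (renᵗ-id _) (⊛-varsΛ (Wt A) xs σ)))) tt))

Tᶜ-realizable : ∀ {l Γ} (A : MFm l Γ) → Realizable (A ⊃ₘ ◇ A)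
Tᶜ-realizable {Γ = Γ} A = realizable-⊃ A (◇ A) F []ᵗ λ {Δ} σ xs vs →
  let Φ = ∣ A ∣ σ xs (subᵗ ((xs ++ᵗ vs) ⊛ σ) F) ∷ []
      hs = proj₁ (splitᵗ (Wt (¬ₘ A)) vs)
      ¬A : Der Δ (∣ □ (¬ₘ A) ∣ σ hs []ᵗ ∷ Φ)
                 (∣ A ∣ σ xs (appsᵗ (Ch A) (proj₁ (splitᵗ MA hs)) (xs ++ᵗ []ᵗ)) ⊃ ⊥F)
      ¬A = subst (Der Δ _) (∣¬∣-++ A σ hs xs) (□-inst (¬ₘ A) (ass (here refl)) (xs ++ᵗ []ᵗ))
  in ⊃I (subst (Der Δ Φ) (sym (∣◇∣-unfold A σ vs))
          (⊃I (⊃E ¬A (conv (ass (there (here refl)))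
                            (∣∣-cong A (λ _ → refl≈) ≈ᵗ-refl (F-β σ xs vs))))))
  where
  W = Wt A
  K = Ch (◇ A)
  MA = map ((W ++ []) ⇛_) (Ch A)
  F : Tms ((W ++ K) ⊕ Γ) (Ch A)
  F = appsᵗ (Ch A) (proj₁ (splitᵗ MA (proj₁ (splitᵗ (Wt (¬ₘ A)) (sndΛ W K))))) (fstΛ W K ++ᵗ []ᵗ)
  F-β : ∀ {Δ} (σ : Sub Γ Δ) xs vs →
        subᵗ ((xs ++ᵗ vs) ⊛ σ) F
        ≈ᵗ appsᵗ (Ch A) (proj₁ (splitᵗ MA (proj₁ (splitᵗ (Wt (¬ₘ A)) vs)))) (xs ++ᵗ []ᵗ)
  F-β σ xs vs =
    appsᵗ-sub≈ (Ch A) (split₁-sub≈ MA (split₁-sub≈ (Wt (¬ₘ A)) (⊛-sndΛ-++ᵗ W K xs vs σ)))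
               (++ᵗ-sub≈ (⊛-fstΛ-++ᵗ W K xs vs σ) tt)

-- ◇ A has no witnesses, so a witness of ¬ ◇ A is a tuple of nullary functions.
nullaryᵗ : ∀ {Δ} (cs : List Ty) → Tms Δ cs → Tms Δ (map ([] ⇛_) cs)
nullaryᵗ []       []ᵗ       = []ᵗ
nullaryᵗ (c ∷ cs) (t ∷ᵗ ts) = t ∷ᵗ nullaryᵗ cs ts

nullaryᵗ-sub≈ : ∀ {Δ Δ'} (cs : List Ty) {τ : Sub Δ Δ'} {ts : Tms Δ cs} {ts'} →
                subᵗ τ ts ≈ᵗ ts' → subᵗ τ (nullaryᵗ cs ts) ≈ᵗ nullaryᵗ cs ts'
nullaryᵗ-sub≈ []       {ts = []ᵗ}     {[]ᵗ}       h        = tt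
nullaryᵗ-sub≈ (c ∷ cs) {ts = t ∷ᵗ ts} {t' ∷ᵗ ts'} (h , hs) = h , nullaryᵗ-sub≈ cs hs

appsᵗ-nullaryᵗ : ∀ {Δ} (cs : List Ty) (ts : Tms Δ cs) → appsᵗ cs (nullaryᵗ cs ts) []ᵗ ≡ ts
appsᵗ-nullaryᵗ []       []ᵗ       = refl
appsᵗ-nullaryᵗ (c ∷ cs) (t ∷ᵗ ts) = cong (t ∷ᵗ_) (appsᵗ-nullaryᵗ cs ts)

◇◇⇒¬¬◇ : ∀ {l Γ Δ Φ} (A : MFm l Γ) (σ : Sub Γ Δ) (vs : Tms Δ (Ch (◇ A))) →
  Der Δ Φ (∣ ◇ (◇ A) ∣ σ []ᵗ ((nullaryᵗ (Ch (◇ A)) vs ++ᵗ []ᵗ) ++ᵗ []ᵗ)) →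
  Der Δ Φ ((∣ ◇ A ∣ σ []ᵗ vs ⊃ ⊥F) ⊃ ⊥F)
◇◇⇒¬¬◇ {Δ = Δ} {Φ} A σ vs d =
  subst (λ Y → Der Δ Φ (Y ⊃ ⊥F))
    (trans (∣¬∣-++ (◇ A) σ ks []ᵗ) (cong (λ zs → ∣ ◇ A ∣ σ []ᵗ zs ⊃ ⊥F) apps-ks))
    (conv (subst (Der Δ Φ) (∣⊃∣-++ (□ (¬ₘ (◇ A))) (atₘ false) σ []ᵗ []ᵗ ks []ᵗ) d)
       (⊃≈ (∣∣-cong (¬ₘ (◇ A)) (λ x → ≡⇒≈ (ren-id (σ x))) (≡⇒≈ᵗ (renᵗ-id ks)) tt) (at≈ refl≈)))
  where
  K = Ch (◇ A)
  ks : Tms Δ (Wt (¬ₘ (◇ A)))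
  ks = nullaryᵗ K vs ++ᵗ []ᵗ
  apps-ks : appsᵗ K (proj₁ (splitᵗ (map ([] ⇛_) K) ks)) []ᵗ ≡ vs
  apps-ks = trans (cong (λ P → appsᵗ K (proj₁ P) []ᵗ) (splitᵗ-++ᵗ (map ([] ⇛_) K) (nullaryᵗ K vs) []ᵗ))
                  (appsᵗ-nullaryᵗ K vs)

-- ◇ ◇ A ⊃ ◇ A is ¬¬¬ X ⊃ ¬ X for X = |□ ¬ A|.
4ᶜ-realizable : ∀ {l Γ} (A : MFm l Γ) → Realizable (◇ (◇ A) ⊃ₘ ◇ A)
4ᶜ-realizable {Γ = Γ} A = realizable-⊃ (◇ (◇ A)) (◇ A) F []ᵗ λ { {Δ} σ []ᵗ vs →
  let Φ = ∣ ◇ (◇ A) ∣ σ []ᵗ (subᵗ (vs ⊛ σ) F) ∷ [] in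
  ⊃I (subst (Der Δ Φ) (sym (∣◇∣-unfold A σ vs))
        (⊃E ¬¬¬⇒¬ (subst (λ Y → Der Δ Φ ((Y ⊃ ⊥F) ⊃ ⊥F)) (∣◇∣-unfold A σ vs)
          (◇◇⇒¬¬◇ A σ vs (conv (ass (here refl)) (∣∣-cong (◇ (◇ A)) (λ _ → refl≈) tt (F-β σ vs))))))) }
  where
  K = Ch (◇ A)
  F : Tms (K ⊕ Γ) (Ch (◇ (◇ A)))
  F = (nullaryᵗ K (varsΛ K) ++ᵗ []ᵗ) ++ᵗ []ᵗ
  F-β : ∀ {Δ} (σ : Sub Γ Δ) vs → subᵗ (vs ⊛ σ) F ≈ᵗ (nullaryᵗ K vs ++ᵗ []ᵗ) ++ᵗ []ᵗ
  F-β σ vs = ++ᵗ-sub≈ (++ᵗ-sub≈ (nullaryᵗ-sub≈ K (≡⇒≈ᵗ (⊛-varsΛ K vs σ))) tt) tt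

□-K : ∀ {l Γ Δ} (A B : MFm l Γ) (σ : Sub Γ Δ) fs gs q →
      Der Δ [] (∣ □ (A ⊃ₘ B) ∧ₘ □ A ∣ σ ((fs ++ᵗ gs) ++ᵗ q) []ᵗ ⊃ ∣ □ B ∣ σ (appsᵗ (Wt B) gs q) []ᵗ)
□-K {Γ = Γ} {Δ} A B σ fs gs q =
  subst (λ H → Der Δ [] (H ⊃ ∣ □ B ∣ σ (appsᵗ (Wt B) gs q) []ᵗ))
        (sym (∣∧∣-++ (□ (A ⊃ₘ B)) (□ A) σ (fs ++ᵗ gs) q []ᵗ []ᵗ))
    (⊃I (∀*I (Ch B) (subst (λ xs → Der E Φ (∣ B ∣ σr xs vB)) (sym (renᵗ-appsᵗ r (Wt B) gs q))
                      (⊃E A⊃B (□-inst A (∣∣-renD (□ A) r {ys = []ᵗ} (∧E₂ (ass (here refl)))) ys)))))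
  where
  E = Ch B ++ Δ
  r = wk* {Δ} (Ch B)
  vB = varsᵗ {Δ} (Ch B)
  σr : Sub Γ E
  σr x = ren r (σ x)
  Φ = renF r (∣ □ (A ⊃ₘ B) ∣ σ (fs ++ᵗ gs) []ᵗ ∧ ∣ □ A ∣ σ q []ᵗ) ∷ []
  ys = appsᵗ (Ch A) (renᵗ r fs) (renᵗ r q ++ᵗ vB)
  A⊃B : Der E Φ (∣ A ∣ σr (renᵗ r q) ys ⊃ ∣ B ∣ σr (appsᵗ (Wt B) (renᵗ r gs) (renᵗ r q)) vB)
  A⊃B = subst (Der E Φ) (∣⊃∣-++ A B σr _ _ _ vB)
          (□-inst (A ⊃ₘ B)
             (subst (λ ws → Der E Φ (∣ □ (A ⊃ₘ B) ∣ σr ws []ᵗ)) (renᵗ-++ᵗ r fs gs)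
                (∣∣-renD (□ (A ⊃ₘ B)) r {ys = []ᵗ} (∧E₁ (ass (here refl)))))
             (renᵗ r q ++ᵗ vB))

K-realizable : ∀ {l Γ} (A B : MFm l Γ) → Realizable ((□ (A ⊃ₘ B) ∧ₘ □ A) ⊃ₘ □ B)
K-realizable A B = realizable-⊃ (□ (A ⊃ₘ B) ∧ₘ □ A) (□ B) []ᵗ G λ { σ xs []ᵗ →
  let p = proj₁ (splitᵗ WI xs)
      q = proj₂ (splitᵗ WI xs)
      fs = proj₁ (splitᵗ MA p)
      gs = proj₂ (splitᵗ MA p)
  in conv (□-K A B σ fs gs q)
       (⊃≈ (∣∣-cong (□ (A ⊃ₘ B) ∧ₘ □ A) (λ _ → refl≈)
              (≡⇒≈ᵗ (trans (cong (_++ᵗ q) (splitᵗ-join MA p)) (splitᵗ-join WI xs))) tt)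
           (∣∣-cong (□ B) (λ _ → refl≈)
              (≈ᵗ-sym (appsᵗ-sub≈ (Wt B) (split₂-sub≈ MA (⊛-fstΛ WI (Wt A) xs σ))
                                         (⊛-sndΛ WI (Wt A) xs σ))) tt)) }
  where
  WI = Wt (A ⊃ₘ B)
  MA = map ((Wt A ++ Ch B) ⇛_) (Ch A)
  G = appsᵗ (Wt B) (proj₂ (splitᵗ MA (fstΛ WI (Wt A)))) (sndΛ WI (Wt A))

mainTheorem1 : (l : Lang) (Γ : List Ty) (A B : MFm l Γ) →
    Realizable (□ A ⊃ₘ A)
    × Realizable (A ⊃ₘ ◇ A)
    × Realizable (□ A ⊃ₘ □ (□ A))
    × Realizable (◇ (◇ A) ⊃ₘ ◇ A)
    × Realizable ((□ (A ⊃ₘ B) ∧ₘ □ A) ⊃ₘ □ B)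
mainTheorem1 l Γ A B =
  T-realizable A , Tᶜ-realizable A , 4-realizable A , 4ᶜ-realizable A , K-realizable A B
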